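{- Let $G=(V,E)$ be a connected graph and let $\mathcal{T}=(\mathcal{P},\mathcal{E})$ be a layering tree of $G$ with respect to a vertex $s$. For any $i\geq \ell(\mathcal{T})+2$ and any $k\leq i-\ell(\mathcal{T})-2$, there is an algorithm that computes $\mathcal{T}_k$ from $G_i$ alone (and no further information about $G$), using no shortest path queries.
   Context: All graphs are simple, unweighted, undirected; $d_G$ is shortest-path distance. For a vertex $s$, the BFS layers are $L_i=\{v: d_G(s,v)=i\}$, $L_{\le j}=\bigcup_{i\le j}L_i$, $L_{\le -1}=\emptyset$. $G_i$ denotes the induced subgraph $G[L_{\le i-1}]$. For each $i\ge 0$, let $S_i^1,\dots,S_i^{s_i}$ be the connected components of $G\setminus L_{\le i-1}$ and $P_i^j=S_i^j\cap L_i$; these nonempty sets are the parts at layer $i$, $\mathcal{P}_i$ is the set of parts at layer $i$, and $\mathcal{P}=\bigcup_i\mathcal{P}_i$. The layering tree $\mathcal{T}=(\mathcal{P},\mathcal{E})$ has the parts as vertices, with $P,P'$ adjacent iff some $u\in P$, $u'\in P'$ are adjacent in $G$. $\mathcal{T}_k$ is the subtree of $\mathcal{T}$ induced by $\bigcup_{i\le k-1}\mathcal{P}_i$ (parts at layers $0,\dots,k-1$). The length of $\mathcal{T}$ is $\ell(\mathcal{T})=\max_{P\in\mathcal{P}}\max_{u,v\in P} d_G(u,v)$. Shortest path queries are queries to an oracle returning $d_G(u,v)$ for given $u,v$. -}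

module Defs where

open import Data.Nat using (ℕ; zero; suc; _+_; _≤_; _<_)
open import Data.Fin using (Fin)
open import Data.Bool using (Bool; true; false)
open import Data.Product using (Σ; ∃; _×_; _,_)
open import Relation.Binary.PropositionalEquality using (_≡_)
open import Relation.Nullary using (¬_)

record Graph (n : ℕ) : Set where
  field
    adj     : Fin n → Fin n → Bool
    symm    : ∀ u v → adj u v ≡ adj v u
    irrefl  : ∀ v → adj v v ≡ false
open Graph public

module _ {n : ℕ} (G : Graph n) where

  data Walk : Fin n → Fin n → ℕ → Set where
    nil  : ∀ {u} → Walk u u zero
    cons : ∀ {u w v m} → adj G u w ≡ true → Walk w v m → Walk u v (suc m)

  Connected : Set
  Connected = ∀ u v → ∃ λ m → Walk u v m

  Dist : Fin n → Fin n → ℕ → Set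
  Dist u v d = Walk u v d × (∀ m → Walk u v m → d ≤ m)

  data WalkIn (P : Fin n → Set) : Fin n → Fin n → Set where
    here : ∀ {u} → P u → WalkIn P u u
    step : ∀ {u w v} → P u → adj G u w ≡ true → WalkIn P w v → WalkIn P u v

  module _ (s : Fin n) where

    -- w ∉ L_{≤ j-1}, i.e. d_G(s,w) ≥ j.
    OutsideBall : ℕ → Fin n → Set
    OutsideBall j w = ∀ d → Dist s w d → j ≤ d

    -- u and v lie in the same part at layer j: both in L_j and in the same
    -- connected component of G \ L_{≤ j-1}.
    SamePart : ℕ → Fin n → Fin n → Set
    SamePart j u v = Dist s u j × Dist s v j × WalkIn (OutsideBall j) u v

    -- The part at layer j containing u and the (distinct) part at layer j'
    -- containing v are adjacent in the layering tree.
    PartAdj : ℕ → ℕ → Fin n → Fin n → Set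
    PartAdj j j' u v =
      ¬ (j ≡ j' × SamePart j u v) ×
      (Σ (Fin n) λ u' → Σ (Fin n) λ v' →
         SamePart j u u' × SamePart j' v v' × adj G u' v' ≡ true)

    IsLength : ℕ → Set
    IsLength ℓ =
      (∀ j u v d → SamePart j u v → Dist u v d → d ≤ ℓ) ×
      (∃ λ j → Σ (Fin n) λ u → Σ (Fin n) λ v → SamePart j u v × Dist u v ℓ)

    -- (m, adjH, sH, e) is a presentation of G_i = G[L_{≤ i-1}] (together with
    -- the root s): e is an injective relabelling of Fin m onto L_{≤ i-1},
    -- adjH is the induced adjacency and sH is the label of s.
    Presents : ℕ → (m : ℕ) → (Fin m → Fin m → Bool) → Fin m → (Fin m → Fin n) → Set
    Presents i m adjH sH e =
      (∀ x y → e x ≡ e y → x ≡ y) ×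
      (∀ x → ∃ λ d → Dist s (e x) d × d < i) ×
      (∀ v d → Dist s v d → d < i → ∃ λ x → e x ≡ v) ×
      (e sH ≡ s) ×
      (∀ x y → adjH x y ≡ adj G (e x) (e y))

-- An algorithm reading only G_i (a graph on Fin m with a root), and the
-- numbers i and k, and outputting the layering subtree T_k, encoded on the
-- vertices of G_i as a pair (same-part relation, part-adjacency relation).
Algorithm : Set
Algorithm = ℕ → ℕ → (m : ℕ) → (Fin m → Fin m → Bool) → Fin m →
            (Fin m → Fin m → Bool) × (Fin m → Fin m → Bool)

-- Let δ = d_G(s, ·), let j < k and put q = j + ⌈ℓ/2⌉.  Two vertices of a part at layer j
-- are joined by a walk in G ∖ L_{≤ j-1}.  Replace every vertex of that walk lying above
-- layer q by a layer-q vertex reached from it by descending BFS parents.  Consecutive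
-- replacements are then either adjacent vertices of layers j..q, or two layer-q vertices of
-- a common part at layer q; the latter are at distance d ≤ ℓ, and a geodesic between them
-- stays within layers q ± d/2, hence inside layers j..i-1.  So every part at a layer j < k
-- is already connected inside G_i.  As distances from s are the same in G_i as in G, the
-- layering tree of G_i truncated at layer k is T_k, and it is found by exhaustive search.

module Submission where

open import Defs
open import Data.Nat using (ℕ; zero; suc; _+_; _∸_; _≤_; _<_; z≤n; s≤s; _≤?_; _≟_; ⌈_/2⌉)
open import Data.Nat.Properties
open import Data.Nat.Induction using (<-rec)
open import Data.Nat.Tactic.RingSolver using (solve-∀)
open import Algebra.Properties.CommutativeSemigroup +-commutativeSemigroup using (interchange)
open import Data.Fin using (Fin; zero; suc)
open import Data.Fin.Properties using (any?; injective⇒≤) renaming (_≟_ to _≟ᶠ_)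
open import Data.Bool using (Bool; true; false; _∨_; if_then_else_)
open import Data.Bool.Properties using (∨-comm; ∨-idem) renaming (_≟_ to _≟ᵇ_)
open import Data.Product using (Σ; ∃; _×_; _,_; proj₁; proj₂)
open import Data.Sum using (_⊎_; inj₁; inj₂)
open import Data.List using (List; []; _∷_; length; lookup)
import Data.List.Relation.Unary.All as All
open import Data.List.Relation.Unary.All.Properties using (¬Any⇒All¬)
import Data.List.Relation.Unary.Any as Any
open import Data.List.Relation.Unary.Any using (here; there)
open import Data.List.Relation.Unary.AllPairs using ([]; _∷_)
open import Data.List.Relation.Unary.Unique.Propositional using (Unique)
open import Data.List.Membership.Propositional using (_∈_)
open import Data.List.Membership.Propositional.Properties using (∈-lookup)
open import Function using (_∘_; id)
open import Function.Bundles using (_⇔_; mk⇔; module Equivalence)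
open import Function.Construct.Composition using (_⇔-∘_)
open import Function.Definitions using (Injective)
open import Relation.Binary.PropositionalEquality using (_≡_; refl; sym; trans; cong; cong₂; subst; subst₂)
open import Relation.Nullary using (¬_; Dec; yes; no; does; contradiction)
open import Relation.Nullary.Decidable using (map′; _×-dec_; ¬?)
open import Relation.Unary using (Decidable)

open Equivalence using (to; from)

m+m≤n+n⇒m≤n : ∀ {m n} → m + m ≤ n + n → m ≤ n
m+m≤n+n⇒m≤n le = ≮⇒≥ λ n<m → <⇒≱ (+-mono-< n<m n<m) le

m+m<n+n⇒m<n : ∀ {m n} → m + m < n + n → m < n
m+m<n+n⇒m<n lt = ≰⇒> λ n≤m → <⇒≱ lt (+-mono-≤ n≤m n≤m)

n≤⌈n/2⌉+⌈n/2⌉ : ∀ n → n ≤ ⌈ n /2⌉ + ⌈ n /2⌉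
n≤⌈n/2⌉+⌈n/2⌉ n =
  subst (_≤ ⌈ n /2⌉ + ⌈ n /2⌉) (⌊n/2⌋+⌈n/2⌉≡n n) (+-monoˡ-≤ ⌈ n /2⌉ (⌊n/2⌋≤⌈n/2⌉ n))

⌈n/2⌉+⌈n/2⌉≤1+n : ∀ n → ⌈ n /2⌉ + ⌈ n /2⌉ ≤ suc n
⌈n/2⌉+⌈n/2⌉≤1+n n =
  subst (⌈ n /2⌉ + ⌈ n /2⌉ ≤_) (⌊n/2⌋+⌈n/2⌉≡n (suc n)) (+-monoʳ-≤ ⌈ n /2⌉ (⌊n/2⌋≤⌈n/2⌉ (suc n)))

a+a+b+c≡[a+b]+[a+c] : ∀ a b c → a + a + b + c ≡ (a + b) + (a + c)
a+a+b+c≡[a+b]+[a+c] = solve-∀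

does≡true⇔ : ∀ {A : Set} (a? : Dec A) → (does a? ≡ true) ⇔ A
does≡true⇔ (yes a) = mk⇔ (λ _ → a) (λ _ → refl)
does≡true⇔ (no ¬a) = mk⇔ (λ ()) (λ a → contradiction a ¬a)

lookup-injective : ∀ {A : Set} {xs : List A} → Unique xs → Injective _≡_ _≡_ (lookup xs)
lookup-injective {xs = _ ∷ _} _ {zero} {zero} _ = refl
lookup-injective {xs = _ ∷ _} (x∉ ∷ _) {zero} {suc j} eq =
  contradiction eq (All.lookup x∉ (∈-lookup j))
lookup-injective {xs = _ ∷ _} (x∉ ∷ _) {suc i} {zero} eq =
  contradiction (sym eq) (All.lookup x∉ (∈-lookup i))
lookup-injective {xs = _ ∷ _} (_ ∷ uniq) {suc i} {suc j} eq = cong suc (lookup-injective uniq eq)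

unique⇒length≤ : ∀ {n} {xs : List (Fin n)} → Unique xs → length xs ≤ n
unique⇒length≤ uniq = injective⇒≤ (lookup-injective uniq)

-- Dist G u v d unfolds to Minimal (λ r → Walk G u v r) d, and OutsideBall G s j w to
-- ∀ d → Minimal (λ r → Walk G s w r) d → j ≤ d.
Minimal : (ℕ → Set) → ℕ → Set
Minimal P d = P d × (∀ d′ → P d′ → d ≤ d′)

minimal-unique : ∀ {P d d′} → Minimal P d → Minimal P d′ → d ≡ d′
minimal-unique (pd , min) (pd′ , min′) = ≤-antisym (min _ pd′) (min′ _ pd)

module _ {P : ℕ → Set} (P? : Decidable P) where

  least : ∀ {r} → P r → ∃ (Minimal P)
  least {r} = <-rec (λ r → P r → ∃ (Minimal P)) search r
    where
    search : ∀ r → (∀ {r′} → r′ < r → P r′ → ∃ (Minimal P)) → P r → ∃ (Minimal P)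
    search r smaller pr with anyUpTo? P? r
    ... | yes (r′ , r′<r , pr′) = smaller r′<r pr′
    ... | no none = r , pr , λ d pd → ≮⇒≥ λ d<r → none (d , d<r , pd)

  minimal? : Decidable (Minimal P)
  minimal? d = map′ minimal (λ (pd , min) → pd , λ (d′ , d′<d , pd′) → <⇒≱ d′<d (min d′ pd′))
                     (P? d ×-dec ¬? (anyUpTo? P? d))
    where
    minimal : P d × ¬ (∃ λ d′ → d′ < d × P d′) → Minimal P d
    minimal (pd , none) = pd , λ d′ pd′ → ≮⇒≥ λ d′<d → none (d′ , d′<d , pd′)

  minima-above? : ∀ j → Dec (∀ d → Minimal P d → j ≤ d)
  minima-above? j = map′ above none-below (¬? (anyUpTo? P? j))
    where
    above : ¬ (∃ λ d → d < j × P d) → ∀ d → Minimal P d → j ≤ d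
    above none d (pd , _) = ≮⇒≥ λ d<j → none (d , d<j , pd)
    none-below : (∀ d → Minimal P d → j ≤ d) → ¬ (∃ λ d → d < j × P d)
    none-below minima≥j (d , d<j , pd) with least pd
    ... | d₀ , min₀ = <⇒≱ (≤-<-trans (proj₂ min₀ d pd) d<j) (minima≥j d₀ min₀)

module Walks {n : ℕ} (G : Graph n) where

  adj-sym : ∀ {u w} → adj G u w ≡ true → adj G w u ≡ true
  adj-sym {u} {w} a = trans (symm G w u) a

  snoc : ∀ {u v w r} → Walk G u v r → adj G v w ≡ true → Walk G u w (suc r)
  snoc nil a = cons a nil
  snoc (cons b c) a = cons b (snoc c a)

  unsnoc : ∀ {u w r} → Walk G u w (suc r) → ∃ λ p → Walk G u p r × adj G p w ≡ true
  unsnoc (cons a nil) = _ , nil , a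
  unsnoc (cons a (cons b c)) with unsnoc (cons b c)
  ... | p , c′ , a′ = p , cons a c′ , a′

  walk? : ∀ r u v → Dec (Walk G u v r)
  walk? zero u v = map′ (λ { refl → nil }) (λ { nil → refl }) (u ≟ᶠ v)
  walk? (suc r) u v = map′ (λ (_ , a , c) → cons a c) (λ { (cons a c) → _ , a , c })
    (any? λ w → (adj G u w ≟ᵇ true) ×-dec walk? r w v)

  walk⇒Dist : ∀ {u v r} → Walk G u v r → ∃ (Dist G u v)
  walk⇒Dist {u} {v} = least (λ r → walk? r u v)

  dist? : ∀ u v d → Dec (Dist G u v d)
  dist? u v = minimal? (λ r → walk? r u v)

  outsideBall? : ∀ s j w → Dec (OutsideBall G s j w)
  outsideBall? s j w = minima-above? (λ r → walk? r s w) j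

  module _ {P : Fin n → Set} where

    WalkIn-head : ∀ {u v} → WalkIn G P u v → P u
    WalkIn-head (here p) = p
    WalkIn-head (step p _ _) = p

    _++_ : ∀ {u v w} → WalkIn G P u v → WalkIn G P v w → WalkIn G P u w
    here _ ++ d = d
    step p a c ++ d = step p a (c ++ d)

    WalkIn-reverse : ∀ {u v} → WalkIn G P u v → WalkIn G P v u
    WalkIn-reverse (here p) = here p
    WalkIn-reverse (step p a c) = WalkIn-reverse c ++ step (WalkIn-head c) (adj-sym a) (here p)

  WalkIn-map : ∀ {P Q : Fin n → Set} → (∀ {z} → P z → Q z) → ∀ {u v} → WalkIn G P u v → WalkIn G Q u v
  WalkIn-map f (here p) = here (f p)
  WalkIn-map f (step p a c) = step (f p) a (WalkIn-map f c)

  data WalkInOfLength (P : Fin n → Set) : Fin n → Fin n → ℕ → Set where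
    here : ∀ {u} → P u → WalkInOfLength P u u zero
    step : ∀ {u w v r} → P u → adj G u w ≡ true → WalkInOfLength P w v r → WalkInOfLength P u v (suc r)

  module _ {P : Fin n → Set} where

    forget-length : ∀ {u v r} → WalkInOfLength P u v r → WalkIn G P u v
    forget-length (here p) = here p
    forget-length (step p a c) = step p a (forget-length c)

    vertices : ∀ {u v r} → WalkInOfLength P u v r → List (Fin n)
    vertices {u} (here _) = u ∷ []
    vertices {u} (step _ _ c) = u ∷ vertices c

    length-vertices : ∀ {u v r} (c : WalkInOfLength P u v r) → length (vertices c) ≡ suc r
    length-vertices (here _) = refl
    length-vertices (step _ _ c) = cong suc (length-vertices c)

    suffix-from : ∀ {x u v r} (c : WalkInOfLength P u v r) → x ∈ vertices c →
                  Σ ℕ λ r′ → Σ (WalkInOfLength P x v r′) λ d → Unique (vertices c) → Unique (vertices d)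
    suffix-from c@(here _) (here refl) = _ , c , id
    suffix-from c@(step _ _ _) (here refl) = _ , c , id
    suffix-from (step _ _ c) (there x∈c) with suffix-from c x∈c
    ... | r′ , d , uniq = r′ , d , λ { (_ ∷ c-uniq) → uniq c-uniq }

    loop-erase : ∀ {u v} → WalkIn G P u v → Σ ℕ λ r → Σ (WalkInOfLength P u v r) λ c → Unique (vertices c)
    loop-erase (here p) = _ , here p , All.[] ∷ []
    loop-erase {u} (step p a c) with loop-erase c
    ... | r , d , d-uniq with Any.any? (u ≟ᶠ_) (vertices d)
    ...   | yes u∈d = let r′ , d′ , uniq = suffix-from d u∈d in r′ , d′ , uniq d-uniq
    ...   | no u∉d = suc r , step p a d , ¬Any⇒All¬ _ u∉d ∷ d-uniq

    short-walkIn : ∀ {u v} → WalkIn G P u v → ∃ λ r → r < n × WalkInOfLength P u v r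
    short-walkIn c with loop-erase c
    ... | r , d , uniq = r , subst (_≤ n) (length-vertices d) (unique⇒length≤ uniq) , d

    walkInOfLength? : Decidable P → ∀ r u v → Dec (WalkInOfLength P u v r)
    walkInOfLength? P? zero u v =
      map′ (λ { (refl , p) → here p }) (λ { (here p) → refl , p }) ((u ≟ᶠ v) ×-dec P? u)
    walkInOfLength? P? (suc r) u v =
      map′ (λ (p , _ , a , c) → step p a c) (λ { (step p a c) → p , _ , a , c })
        (P? u ×-dec any? λ w → (adj G u w ≟ᵇ true) ×-dec walkInOfLength? P? r w v)

    walkIn? : Decidable P → ∀ u v → Dec (WalkIn G P u v)
    walkIn? P? u v = map′ (λ (_ , _ , c) → forget-length c) short-walkIn
                          (anyUpTo? (λ r → walkInOfLength? P? r u v) n)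

module LayeringTree {n : ℕ} (G : Graph n) where
  open Walks G

  samePart? : ∀ s j u v → Dec (SamePart G s j u v)
  samePart? s j u v = dist? s u j ×-dec dist? s v j ×-dec walkIn? (outsideBall? s j) u v

  partAdj? : ∀ s j j′ u v → Dec (PartAdj G s j j′ u v)
  partAdj? s j j′ u v =
    ¬? ((j ≟ j′) ×-dec samePart? s j u v) ×-dec
    any? λ u′ → any? λ v′ → samePart? s j u u′ ×-dec samePart? s j′ v v′ ×-dec (adj G u′ v′ ≟ᵇ true)

  SamePartBelow : Fin n → ℕ → Fin n → Fin n → Set
  SamePartBelow s k u v = ∃ λ j → j < k × SamePart G s j u v

  PartAdjBelow : Fin n → ℕ → Fin n → Fin n → Set
  PartAdjBelow s k u v = ∃ λ j → ∃ λ j′ → j < k × j′ < k × PartAdj G s j j′ u v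

  samePartBelow? : ∀ s k u v → Dec (SamePartBelow s k u v)
  samePartBelow? s k u v = anyUpTo? (λ j → samePart? s j u v) k

  partAdjBelow? : ∀ s k u v → Dec (PartAdjBelow s k u v)
  partAdjBelow? s k u v =
    map′ (λ (j , j<k , j′ , j′<k , adjacent) → j , j′ , j<k , j′<k , adjacent)
         (λ (j , j′ , j<k , j′<k , adjacent) → j , j<k , j′ , j′<k , adjacent)
         (anyUpTo? (λ j → anyUpTo? (λ j′ → partAdj? s j j′ u v) k) k)

-- The input of the algorithm is an arbitrary Boolean matrix, so it is first made into a graph;
-- under Presents this changes nothing (symmetrize-pullback).
symmetrize : ∀ {m} → (Fin m → Fin m → Bool) → Graph m
symmetrize {m} A = record { adj = adjˢ ; symm = symmˢ ; irrefl = irreflˢ }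
  where
  adjˢ : Fin m → Fin m → Bool
  adjˢ x y = if does (x ≟ᶠ y) then false else A x y ∨ A y x
  symmˢ : ∀ x y → adjˢ x y ≡ adjˢ y x
  symmˢ x y with x ≟ᶠ y | y ≟ᶠ x
  ... | yes _ | yes _ = refl
  ... | no _ | no _ = ∨-comm (A x y) (A y x)
  ... | yes refl | no x≢x = contradiction refl x≢x
  ... | no x≢y | yes refl = contradiction refl x≢y
  irreflˢ : ∀ x → adjˢ x x ≡ false
  irreflˢ x with x ≟ᶠ x
  ... | yes _ = refl
  ... | no x≢x = contradiction refl x≢x

symmetrize-pullback : ∀ {m n} {A : Fin m → Fin m → Bool} (G : Graph n) (f : Fin m → Fin n) →
                      (∀ x y → A x y ≡ adj G (f x) (f y)) →
                      ∀ x y → adj (symmetrize A) x y ≡ adj G (f x) (f y)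
symmetrize-pullback G f A≡ x y with x ≟ᶠ y
... | yes refl = sym (irrefl G (f x))
... | no _ rewrite A≡ x y | A≡ y x | symm G (f y) (f x) = ∨-idem _

layeringSubtree : Algorithm
layeringSubtree _ k m adjH sH =
  (λ x y → does (LayeringTree.samePartBelow? H sH k x y)) ,
  (λ x y → does (LayeringTree.partAdjBelow? H sH k x y))
  where
  H : Graph m
  H = symmetrize adjH

module Layers {n : ℕ} (G : Graph n) (s : Fin n) (conn : Connected G) where
  open Walks G

  δ : Fin n → ℕ
  δ w = proj₁ (walk⇒Dist (proj₂ (conn s w)))

  δ-Dist : ∀ w → Dist G s w (δ w)
  δ-Dist w = proj₂ (walk⇒Dist (proj₂ (conn s w)))

  Dist⇒δ : ∀ {w d} → Dist G s w d → δ w ≡ d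
  Dist⇒δ = minimal-unique (δ-Dist _)

  δ-minimal : ∀ {w r} → Walk G s w r → δ w ≤ r
  δ-minimal = proj₂ (δ-Dist _) _

  δ-root : δ s ≡ 0
  δ-root = Dist⇒δ (nil , λ _ _ → z≤n)

  δ-edge : ∀ {u w} → adj G u w ≡ true → δ w ≤ suc (δ u)
  δ-edge a = δ-minimal (snoc (proj₁ (δ-Dist _)) a)

  δ-walk≤ : ∀ {u w r} → Walk G u w r → δ w ≤ δ u + r
  δ-walk≤ {u} nil = m≤m+n (δ u) 0
  δ-walk≤ {u} {w} (cons {w = u′} {m = r} a c) = begin
    δ w            ≤⟨ δ-walk≤ c ⟩
    δ u′ + r       ≤⟨ +-monoˡ-≤ r (δ-edge a) ⟩
    suc (δ u) + r  ≡⟨ +-suc (δ u) r ⟨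
    δ u + suc r    ∎
    where open ≤-Reasoning

  δ-walk≥ : ∀ {u w r} → Walk G u w r → δ u ≤ δ w + r
  δ-walk≥ {u} nil = m≤m+n (δ u) 0
  δ-walk≥ {u} {w} (cons {w = u′} {m = r} a c) = begin
    δ u             ≤⟨ δ-edge (adj-sym a) ⟩
    suc (δ u′)      ≤⟨ s≤s (δ-walk≥ c) ⟩
    suc (δ w + r)   ≡⟨ +-suc (δ w) r ⟨
    δ w + suc r     ∎
    where open ≤-Reasoning

  OutsideBall⇔≤δ : ∀ {j w} → OutsideBall G s j w ⇔ j ≤ δ w
  OutsideBall⇔≤δ {j} = mk⇔ (λ o → o _ (δ-Dist _)) (λ j≤δ d D → subst (j ≤_) (Dist⇒δ D) j≤δ)

  parent : ∀ {w t} → δ w ≡ suc t → ∃ λ p → adj G w p ≡ true × δ p ≡ t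
  parent {w} {t} δw≡1+t with unsnoc (subst (Walk G s w) δw≡1+t (proj₁ (δ-Dist w)))
  ... | p , c , a = p , adj-sym a ,
                    ≤-antisym (δ-minimal c) (≤-pred (subst (_≤ suc (δ p)) δw≡1+t (δ-edge a)))

  descend : ∀ {q w} → q ≤ δ w → ∃ λ a → δ a ≡ q × WalkIn G (λ z → q ≤ δ z) w a
  descend {q} {w} q≤δw = descend-by (δ w ∸ q) (sym (m∸n+n≡m q≤δw))
    where
    descend-by : ∀ r {w} → δ w ≡ r + q → ∃ λ a → δ a ≡ q × WalkIn G (λ z → q ≤ δ z) w a
    descend-by zero {w} δw≡q = w , δw≡q , here (≤-reflexive (sym δw≡q))
    descend-by (suc r) δw≡1+r+q with parent δw≡1+r+q
    ... | p , a , δp≡r+q with descend-by r δp≡r+q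
    ...   | b , δb≡q , c = b , δb≡q , step (subst (q ≤_) (sym δw≡1+r+q) (m≤n+m q (suc r))) a c

  -- ∣ 2 δ z − c ∣ ≤ r, stated without truncated subtraction.
  TwiceLayerWithin : ℕ → ℕ → Fin n → Set
  TwiceLayerWithin c r z = c ≤ δ z + δ z + r × δ z + δ z ≤ c + r

  TwiceLayerWithin-split : ∀ {u z v p r} → Walk G u z p → Walk G z v r →
            TwiceLayerWithin (δ u + δ v) (p + r) z
  TwiceLayerWithin-split {u} {z} {v} {p} {r} pre suf =
    ≤-trans (+-mono-≤ (δ-walk≥ pre) (δ-walk≤ suf)) (≤-reflexive (interchange (δ z) p (δ z) r)) ,
    ≤-trans (+-mono-≤ (δ-walk≤ pre) (δ-walk≥ suf)) (≤-reflexive (interchange (δ u) p (δ v) r))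

  walk-band : ∀ {u v r} → Walk G u v r → WalkIn G (TwiceLayerWithin (δ u + δ v) r) u v
  walk-band {u} {v} = along nil
    where
    along : ∀ {z p r} → Walk G u z p → Walk G z v r → WalkIn G (TwiceLayerWithin (δ u + δ v) (p + r)) z v
    along pre nil = here (TwiceLayerWithin-split pre nil)
    along {p = p} pre (cons {m = r} a c) =
      step (TwiceLayerWithin-split pre (cons a c)) a
        (WalkIn-map (λ {z} → subst (λ t → TwiceLayerWithin (δ u + δ v) t z) (sym (+-suc p r)))
          (along (snoc pre a) c))

module BandedParts {n : ℕ} (G : Graph n) (s : Fin n) (conn : Connected G) (ℓ : ℕ)
  (parts-short : ∀ j u v d → SamePart G s j u v → Dist G u v d → d ≤ ℓ)
  (j i : ℕ) (j+ℓ<i : j + ℓ < i) where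
  open Walks G
  open Layers G s conn

  InBand : Fin n → Set
  InBand z = j ≤ δ z × δ z < i

  h : ℕ
  h = ⌈ ℓ /2⌉

  q : ℕ
  q = j + h

  Above : Fin n → Set
  Above z = q ≤ δ z

  j≤q : j ≤ q
  j≤q = m≤m+n j h

  q<i : q < i
  q<i = ≤-<-trans (+-monoʳ-≤ j (⌈n/2⌉≤n ℓ)) j+ℓ<i

  InBand-at-q : ∀ {z} → δ z ≡ q → InBand z
  InBand-at-q δz≡q = subst (j ≤_) (sym δz≡q) j≤q , subst (_< i) (sym δz≡q) q<i

  twiceLayerWithin⇒InBand : ∀ {d z} → d ≤ ℓ → TwiceLayerWithin (q + q) d z → InBand z
  twiceLayerWithin⇒InBand {d} {z} d≤ℓ (lower , upper) = j≤δz , δz<i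
    where
    open ≤-Reasoning
    j≤δz : j ≤ δ z
    j≤δz = m+m≤n+n⇒m≤n (+-cancelʳ-≤ ℓ (j + j) (δ z + δ z) (begin
      j + j + ℓ          ≤⟨ +-monoʳ-≤ (j + j) (n≤⌈n/2⌉+⌈n/2⌉ ℓ) ⟩
      j + j + (h + h)    ≡⟨ interchange j h j h ⟨
      q + q              ≤⟨ lower ⟩
      δ z + δ z + d      ≤⟨ +-monoʳ-≤ (δ z + δ z) d≤ℓ ⟩
      δ z + δ z + ℓ      ∎))
    δz<i : δ z < i
    δz<i = m+m<n+n⇒m<n (begin-strict
      δ z + δ z                ≤⟨ upper ⟩
      q + q + d                ≤⟨ +-monoʳ-≤ (q + q) d≤ℓ ⟩
      q + q + ℓ                ≡⟨ cong (_+ ℓ) (interchange j h j h) ⟩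
      j + j + (h + h) + ℓ      ≡⟨ a+a+b+c≡[a+b]+[a+c] j (h + h) ℓ ⟩
      (j + (h + h)) + (j + ℓ)  <⟨ +-mono-≤-< j+h+h≤i j+ℓ<i ⟩
      i + i                    ∎)
      where
      j+h+h≤i : j + (h + h) ≤ i
      j+h+h≤i = ≤-trans (+-monoʳ-≤ j (⌈n/2⌉+⌈n/2⌉≤1+n ℓ)) (subst (_≤ i) (sym (+-suc j ℓ)) j+ℓ<i)

  join-in-band : ∀ {a b} → δ a ≡ q → δ b ≡ q → WalkIn G Above a b → WalkIn G InBand a b
  join-in-band {a} {b} δa≡q δb≡q c with walk⇒Dist (proj₂ (conn a b))
  ... | d , D@(geodesic , _) =
    WalkIn-map (twiceLayerWithin⇒InBand (parts-short q a b d same-part D) ∘ at-q) (walk-band geodesic)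
    where
    same-part : SamePart G s q a b
    same-part = subst (Dist G s a) δa≡q (δ-Dist a) , subst (Dist G s b) δb≡q (δ-Dist b) ,
                WalkIn-map (from OutsideBall⇔≤δ) c
    at-q : ∀ {z} → TwiceLayerWithin (δ a + δ b) d z → TwiceLayerWithin (q + q) d z
    at-q {z} = subst (λ c → TwiceLayerWithin c d z) (cong₂ _+_ δa≡q δb≡q)

  Rep : Fin n → Fin n → Set
  Rep w a = (δ w ≤ q × a ≡ w) ⊎ (q < δ w × δ a ≡ q × WalkIn G Above w a)

  rep : ∀ w → ∃ (Rep w)
  rep w with δ w ≤? q
  ... | yes δw≤q = w , inj₁ (δw≤q , refl)
  ... | no δw≰q with descend (<⇒≤ (≰⇒> δw≰q))
  ...   | a , δa≡q , c = a , inj₂ (≰⇒> δw≰q , δa≡q , c)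

  rep-fixed : ∀ {w a} → Rep w a → δ w ≤ q → a ≡ w
  rep-fixed (inj₁ (_ , a≡w)) _ = a≡w
  rep-fixed (inj₂ (q<δw , _)) δw≤q = contradiction δw≤q (<⇒≱ q<δw)

  rep-InBand : ∀ {w a} → j ≤ δ w → Rep w a → InBand a
  rep-InBand j≤δw (inj₁ (δw≤q , refl)) = j≤δw , ≤-<-trans δw≤q q<i
  rep-InBand _ (inj₂ (_ , δa≡q , _)) = InBand-at-q δa≡q

  rep-Above : ∀ {w a} → q ≤ δ w → Rep w a → δ a ≡ q × WalkIn G Above w a
  rep-Above q≤δw (inj₁ (δw≤q , refl)) = ≤-antisym δw≤q q≤δw , here q≤δw
  rep-Above _ (inj₂ (_ , δa≡q , c)) = δa≡q , c

  rep-edge-Above : ∀ {w w′ a a′} → q ≤ δ w → q ≤ δ w′ → adj G w w′ ≡ true → Rep w a → Rep w′ a′ →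
                   WalkIn G InBand a a′
  rep-edge-Above q≤δw q≤δw′ e r r′ with rep-Above q≤δw r | rep-Above q≤δw′ r′
  ... | δa≡q , c | δa′≡q , c′ = join-in-band δa≡q δa′≡q (WalkIn-reverse c ++ step q≤δw e c′)

  rep-edge : ∀ {w w′ a a′} → j ≤ δ w → j ≤ δ w′ → adj G w w′ ≡ true → Rep w a → Rep w′ a′ →
             WalkIn G InBand a a′
  rep-edge j≤δw j≤δw′ e (inj₁ (δw≤q , refl)) (inj₁ (δw′≤q , refl)) =
    step (j≤δw , ≤-<-trans δw≤q q<i) e (here (j≤δw′ , ≤-<-trans δw′≤q q<i))
  rep-edge _ _ e r@(inj₂ (q<δw , _)) r′ =
    rep-edge-Above (<⇒≤ q<δw) (≤-pred (≤-trans q<δw (δ-edge (adj-sym e)))) e r r′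
  rep-edge _ _ e r@(inj₁ _) r′@(inj₂ (q<δw′ , _)) =
    rep-edge-Above (≤-pred (≤-trans q<δw′ (δ-edge e))) (<⇒≤ q<δw′) e r r′

  rep-walk : ∀ {u v} → WalkIn G (OutsideBall G s j) u v → WalkIn G InBand (proj₁ (rep u)) (proj₁ (rep v))
  rep-walk (here o) = here (rep-InBand (to OutsideBall⇔≤δ o) (proj₂ (rep _)))
  rep-walk (step o e c) =
    rep-edge (to OutsideBall⇔≤δ o) (to OutsideBall⇔≤δ (WalkIn-head c)) e (proj₂ (rep _)) (proj₂ (rep _))
    ++ rep-walk c

  samePart⇒WalkIn-band : ∀ {u v} → SamePart G s j u v → WalkIn G InBand u v
  samePart⇒WalkIn-band (Du , Dv , c) =
    subst₂ (WalkIn G InBand) (rep-at-j Du) (rep-at-j Dv) (rep-walk c)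
    where
    rep-at-j : ∀ {w} → Dist G s w j → proj₁ (rep w) ≡ w
    rep-at-j {w} D = rep-fixed (proj₂ (rep w)) (subst (_≤ q) (sym (Dist⇒δ D)) j≤q)

module PresentedBall {n m : ℕ} (G : Graph n) (s : Fin n) (conn : Connected G) (ℓ : ℕ)
  (parts-short : ∀ j u v d → SamePart G s j u v → Dist G u v d → d ≤ ℓ)
  (i k : ℕ) (k+ℓ+2≤i : k + ℓ + 2 ≤ i)
  (adjH : Fin m → Fin m → Bool) (sH : Fin m) (e : Fin m → Fin n)
  (e-injective : ∀ x y → e x ≡ e y → x ≡ y)
  (e-in-ball : ∀ x → ∃ λ d → Dist G s (e x) d × d < i)
  (e-onto-ball : ∀ v d → Dist G s v d → d < i → ∃ λ x → e x ≡ v)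
  (e-root : e sH ≡ s)
  (e-adj : ∀ x y → adjH x y ≡ adj G (e x) (e y)) where
  open Walks G
  open LayeringTree G
  open Layers G s conn

  H : Graph m
  H = symmetrize adjH

  module OnH = LayeringTree H

  H-adj : ∀ x y → adj H x y ≡ adj G (e x) (e y)
  H-adj = symmetrize-pullback G e e-adj

  j<k⇒j+ℓ<i : ∀ {j} → j < k → j + ℓ < i
  j<k⇒j+ℓ<i {j} j<k = ≤-trans (+-monoˡ-≤ ℓ j<k) (≤-trans (m≤m+n (k + ℓ) 2) k+ℓ+2≤i)

  δe<i : ∀ x → δ (e x) < i
  δe<i x with e-in-ball x
  ... | d , D , d<i = subst (_< i) (sym (Dist⇒δ D)) d<i

  preimage : ∀ {w} → δ w < i → ∃ λ x → e x ≡ w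
  preimage {w} = e-onto-ball w (δ w) (δ-Dist w)

  push-walk : ∀ {x y r} → Walk H x y r → Walk G (e x) (e y) r
  push-walk nil = nil
  push-walk (cons {u} {w} a c) = cons (trans (sym (H-adj u w)) a) (push-walk c)

  push-walkIn : ∀ {P Q x y} → (∀ {z} → P z → Q (e z)) → WalkIn H P x y → WalkIn G Q (e x) (e y)
  push-walkIn f (here p) = here (f p)
  push-walkIn f (step {u} {w} p a c) = step (f p) (trans (sym (H-adj u w)) a) (push-walkIn f c)

  edge-bound : ∀ {u w r} → adj G u w ≡ true → δ u + suc r < i → δ w + r < i
  edge-bound {u} {w} {r} a = ≤-<-trans (begin
    δ w + r        ≤⟨ +-monoˡ-≤ r (δ-edge a) ⟩
    suc (δ u) + r  ≡⟨ +-suc (δ u) r ⟨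
    δ u + suc r    ∎)
    where open ≤-Reasoning

  pull-walk : ∀ {x v r} → δ (e x) + r < i → Walk G (e x) v r → ∃ λ y → e y ≡ v × Walk H x y r
  pull-walk {x} _ nil = x , refl , nil
  pull-walk {x} {r = suc r} bound (cons {w = w} a c)
    with preimage (≤-<-trans (m≤m+n (δ w) r) (edge-bound a bound))
  ... | x′ , refl with pull-walk (edge-bound a bound) c
  ...   | y , ey≡v , c′ = y , ey≡v , cons (trans (H-adj x x′) a) c′

  pull-walkIn : ∀ {Q : Fin n → Set} {x v} → (∀ {z} → Q z → δ z < i) →
                WalkIn G Q (e x) v → ∃ λ y → e y ≡ v × WalkIn H (Q ∘ e) x y
  pull-walkIn {x = x} _ (here q) = x , refl , here q
  pull-walkIn {x = x} inBall (step {w = w} q a c) with preimage (inBall (WalkIn-head c))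
  ... | x′ , refl with pull-walkIn inBall c
  ...   | y , ey≡v , c′ = y , ey≡v , step q (trans (H-adj x x′) a) c′

  δ-e-root : δ (e sH) ≡ 0
  δ-e-root = trans (cong δ e-root) δ-root

  geodesicH : ∀ x → Walk H sH x (δ (e x))
  geodesicH x with pull-walk (subst (λ t → t + δ (e x) < i) (sym δ-e-root) (δe<i x))
                             (subst (λ z → Walk G z (e x) (δ (e x))) (sym e-root) (proj₁ (δ-Dist (e x))))
  ... | y , ey≡ex , c = subst (λ z → Walk H sH z (δ (e x))) (e-injective y x ey≡ex) c

  DistH : ∀ x → Dist H sH x (δ (e x))
  DistH x = geodesicH x , λ r c → δ-minimal (subst (λ z → Walk G z (e x) r) e-root (push-walk c))

  Dist⇔ : ∀ {x d} → Dist H sH x d ⇔ Dist G s (e x) d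
  Dist⇔ {x} = mk⇔ (λ D → subst (Dist G s (e x)) (minimal-unique (DistH x) D) (δ-Dist (e x)))
                  (λ D → subst (Dist H sH x) (Dist⇒δ D) (DistH x))

  OutsideBall⇔ : ∀ {j x} → OutsideBall H sH j x ⇔ OutsideBall G s j (e x)
  OutsideBall⇔ = mk⇔ (λ o d D → o d (from Dist⇔ D)) (λ o d D → o d (to Dist⇔ D))

  samePart-push : ∀ {j x y} → SamePart H sH j x y → SamePart G s j (e x) (e y)
  samePart-push (Dx , Dy , c) = to Dist⇔ Dx , to Dist⇔ Dy , push-walkIn (to OutsideBall⇔) c

  samePart-pull : ∀ {j x y} → j + ℓ < i → SamePart G s j (e x) (e y) → SamePart H sH j x y
  samePart-pull {j} {x} {y} j+ℓ<i sp@(Dx , Dy , _)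
    with pull-walkIn proj₂ (BandedParts.samePart⇒WalkIn-band G s conn ℓ parts-short j i j+ℓ<i sp)
  ... | y′ , ey′≡ey , c =
    from Dist⇔ Dx , from Dist⇔ Dy ,
    subst (WalkIn H _ x) (e-injective y′ y ey′≡ey)
      (Walks.WalkIn-map H (λ (j≤δ , _) → from OutsideBall⇔ (from OutsideBall⇔≤δ j≤δ)) c)

  layer-preimage : ∀ {j w} → j < k → Dist G s w j → ∃ λ x → e x ≡ w
  layer-preimage {j} {w} j<k D = e-onto-ball w j D (≤-trans (m≤m+n (suc j) ℓ) (j<k⇒j+ℓ<i j<k))

  partAdj-push : ∀ {j j′ x y} → j < k → PartAdj H sH j j′ x y → PartAdj G s j j′ (e x) (e y)
  partAdj-push j<k (distinct , x′ , y′ , sx , sy , a) =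
    (λ (j≡j′ , sp) → distinct (j≡j′ , samePart-pull (j<k⇒j+ℓ<i j<k) sp)) ,
    e x′ , e y′ , samePart-push sx , samePart-push sy , trans (sym (H-adj x′ y′)) a

  partAdj-pull : ∀ {j j′ x y} → j < k → j′ < k → PartAdj G s j j′ (e x) (e y) → PartAdj H sH j j′ x y
  partAdj-pull j<k j′<k (distinct , u′ , v′ , su , sv , a)
    with layer-preimage j<k (proj₁ (proj₂ su)) | layer-preimage j′<k (proj₁ (proj₂ sv))
  ... | x′ , refl | y′ , refl =
    (λ (j≡j′ , sp) → distinct (j≡j′ , samePart-push sp)) ,
    x′ , y′ , samePart-pull (j<k⇒j+ℓ<i j<k) su , samePart-pull (j<k⇒j+ℓ<i j′<k) sv , trans (H-adj x′ y′) a

  samePartBelow⇔ : ∀ {x y} → OnH.SamePartBelow sH k x y ⇔ SamePartBelow s k (e x) (e y)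
  samePartBelow⇔ = mk⇔ (λ (j , j<k , sp) → j , j<k , samePart-push sp)
                       (λ (j , j<k , sp) → j , j<k , samePart-pull (j<k⇒j+ℓ<i j<k) sp)

  partAdjBelow⇔ : ∀ {x y} → OnH.PartAdjBelow sH k x y ⇔ PartAdjBelow s k (e x) (e y)
  partAdjBelow⇔ = mk⇔ (λ (j , j′ , j<k , j′<k , pa) → j , j′ , j<k , j′<k , partAdj-push j<k pa)
                      (λ (j , j′ , j<k , j′<k , pa) → j , j′ , j<k , j′<k , partAdj-pull j<k j′<k pa)

corollary5 :
  Σ Algorithm λ A →
    ∀ (n : ℕ) (G : Graph n) (s : Fin n) → Connected G →
    ∀ (ℓ : ℕ) → IsLength G s ℓ →
    ∀ (i k : ℕ) → k + ℓ + 2 ≤ i →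
    ∀ (m : ℕ) (adjH : Fin m → Fin m → Bool) (sH : Fin m) (e : Fin m → Fin n) →
    Presents G s i m adjH sH e →
    (∀ x y → (proj₁ (A i k m adjH sH) x y ≡ true) ⇔
               (∃ λ j → j < k × SamePart G s j (e x) (e y))) ×
    (∀ x y → (proj₂ (A i k m adjH sH) x y ≡ true) ⇔
               (∃ λ j → ∃ λ j' → j < k × j' < k × PartAdj G s j j' (e x) (e y)))
corollary5 = layeringSubtree , λ n G s conn ℓ isL i k k+ℓ+2≤i m adjH sH e
                                 (e-injective , e-in-ball , e-onto-ball , e-root , e-adj) →
  let open PresentedBall G s conn ℓ (proj₁ isL) i k k+ℓ+2≤i adjH sH e
                         e-injective e-in-ball e-onto-ball e-root e-adj
  in (λ x y → samePartBelow⇔ ⇔-∘ does≡true⇔ (OnH.samePartBelow? sH k x y)) ,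
     (λ x y → partAdjBelow⇔ ⇔-∘ does≡true⇔ (OnH.partAdjBelow? sH k x y))
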